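{- Let $C_n$ be a cycle on $n$ vertices, and let its complement $\bar{C_n}$ carry the same vertex set-labels as $C_n$. Then $\bar{C_n}$ admits a weak IASI (under these set-labels) if and only if $C_n$ has at most one vertex of set-indexing number greater than $1$.
   Context: All graphs are finite and simple. $\mathbb{N}_0$ denotes the non-negative integers; for $A,B\subseteq\mathbb{N}_0$, $A+B=\{a+b:a\in A,b\in B\}$. An integer additive set-indexer (IASI) of a graph $G$ is an injective map $f:V(G)\to 2^{\mathbb{N}_0}$ such that $g_f:E(G)\to 2^{\mathbb{N}_0}$, $g_f(uv)=f(u)+f(v)$, is injective. The set-indexing number of a vertex $v$ is $|f(v)|$. $f$ is a weak IASI if $|g_f(uv)|=\max(|f(u)|,|f(v)|)$ for every edge $uv$. A single set-labeling of the common vertex set is used for a graph and its complement (a concurrent set-labeling). -}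

module Defs where

open import Data.Nat using (ℕ; zero; suc; _+_; _⊔_; _<_; _≤_)
open import Data.Nat.Properties using (_≟_)
open import Data.Fin using (Fin; toℕ)
open import Data.List using (List; length; map; concatMap; deduplicate)
open import Data.List.Membership.Propositional using (_∈_)
open import Data.Product using (_×_)
open import Data.Sum using (_⊎_)
open import Relation.Binary.PropositionalEquality using (_≡_; _≢_)
open import Relation.Nullary using (¬_)

-- A finite set-label: a finite subset of ℕ₀, represented by a list
-- (duplicates and order are irrelevant).
SetLabel : Set
SetLabel = List ℕ

_≈ˢ_ : SetLabel → SetLabel → Set
A ≈ˢ B = ∀ x → (x ∈ A → x ∈ B) × (x ∈ B → x ∈ A)

card : SetLabel → ℕ
card A = length (deduplicate _≟_ A)

_⊕_ : SetLabel → SetLabel → SetLabel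
A ⊕ B = concatMap (λ a → map (a +_) B) A

CycAdj : (n : ℕ) → Fin n → Fin n → Set
CycAdj n u v =
  (suc (toℕ u) ≡ toℕ v) ⊎ (suc (toℕ v) ≡ toℕ u)
  ⊎ (toℕ u ≡ 0 × suc (toℕ v) ≡ n) ⊎ (toℕ v ≡ 0 × suc (toℕ u) ≡ n)

ComplAdj : (n : ℕ) → Fin n → Fin n → Set
ComplAdj n u v = u ≢ v × ¬ CycAdj n u v

IsIASI : {n : ℕ} → (Fin n → Fin n → Set) → (Fin n → SetLabel) → Set
IsIASI {n} Adj f =
  (∀ u v → f u ≈ˢ f v → u ≡ v)
  × (∀ u v x y → Adj u v → Adj x y → (f u ⊕ f v) ≈ˢ (f x ⊕ f y)
       → (u ≡ x × v ≡ y) ⊎ (u ≡ y × v ≡ x))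

WeakCond : {n : ℕ} → (Fin n → Fin n → Set) → (Fin n → SetLabel) → Set
WeakCond Adj f = ∀ u v → Adj u v → card (f u ⊕ f v) ≡ card (f u) ⊔ card (f v)

IsWeakIASI : {n : ℕ} → (Fin n → Fin n → Set) → (Fin n → SetLabel) → Set
IsWeakIASI Adj f = IsIASI Adj f × WeakCond Adj f

AtMostOneNonSingleton : {n : ℕ} → (Fin n → SetLabel) → Set
AtMostOneNonSingleton {n} f = ∀ (u v : Fin n) → 1 < card (f u) → 1 < card (f v) → u ≡ v

{-# OPTIONS --safe #-}

-- For nonempty finite A, B ⊆ ℕ₀ we have |A + B| = max(|A|, |B|) exactly when one
-- of A, B is a singleton: if b < b′ in B, then the translate A + b together with
-- max A + b′ already has |A| + 1 elements.  The weak IASI of C_n forces every label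
-- to be nonempty, since a vertex labelled ∅ forces the same label on its neighbour,
-- against injectivity.  Two distinct vertices with non-singleton labels are adjacent
-- in C_n or in its complement, and the weak condition fails on either edge; conversely,
-- if at most one label is a non-singleton, every edge of the complement has a
-- singleton end.
module Submission where

open import Defs
open import Data.Nat using (ℕ; zero; suc; _+_; _⊔_; _≤_; _<_; z≤n; s≤s)
open import Data.Nat.Properties
open import Data.Fin as Fin using (Fin; toℕ)
open import Data.Fin.Properties using (toℕ<n; toℕ-fromℕ<)
open import Data.List using (List; []; _∷_; length; map; filter; deduplicate)
open import Data.List.Properties using (filter-notAll; length-map; length-deduplicate)
open import Data.List.Extrema ≤-totalOrder using (max; argmax-sel; xs≤max)
open import Data.List.Membership.Propositional using (_∈_; _∉_; find)
open import Data.List.Membership.Propositional.Properties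
  using (∈-filter⁺; ∈-deduplicate⁺; ∈-deduplicate⁻; ∈-map⁺; ∈-map⁻; ∈-concatMap⁺; ∈-concatMap⁻)
open import Data.List.Relation.Binary.Subset.Propositional using (_⊆_)
import Data.List.Relation.Binary.Subset.Propositional.Properties as ⊆
open import Data.List.Relation.Unary.Any as Any using (here; there)
open import Data.List.Relation.Unary.All as All using (_∷_)
open import Data.List.Relation.Unary.All.Properties using (¬Any⇒All¬)
open import Data.List.Relation.Unary.AllPairs using (_∷_)
open import Data.List.Relation.Unary.Unique.Propositional using (Unique)
open import Data.List.Relation.Unary.Unique.DecPropositional.Properties _≟_
  using (deduplicate-!) renaming (map⁺ to Unique-map⁺)
open import Data.Product using (_×_; _,_; proj₂; ∃; ∃₂)
open import Data.Sum using (_⊎_; inj₁; inj₂; [_,_]′)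
open import Data.Empty using (⊥-elim)
open import Function using (_∘_; id)
open import Relation.Binary.Definitions using (tri<; tri≈; tri>)
open import Relation.Nullary using (¬_; yes; no; ¬?)
open import Relation.Binary.PropositionalEquality
  using (_≡_; _≢_; refl; sym; trans; cong; subst; module ≡-Reasoning)

Unique-length-≤ : ∀ {U V : List ℕ} → Unique U → U ⊆ V → length U ≤ length V
Unique-length-≤ {[]} _ _ = z≤n
Unique-length-≤ {x ∷ U} {V} (x∉U ∷ !U) x∷U⊆V =
  ≤-trans (s≤s (Unique-length-≤ !U U⊆V∖x)) (filter-notAll x≢? V x∈V)
  where
    x≢? = λ y → ¬? (x ≟ y)
    U⊆V∖x : U ⊆ filter x≢? V
    U⊆V∖x y∈U = ∈-filter⁺ x≢? (x∷U⊆V (there y∈U)) (All.lookup x∉U y∈U)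
    x∈V = Any.map (λ x≡y x≢y → x≢y x≡y) (x∷U⊆V (here refl))

Unique-length≤card : ∀ {U A} → Unique U → U ⊆ A → length U ≤ card A
Unique-length≤card U! U⊆A = Unique-length-≤ U! (∈-deduplicate⁺ _≟_ ∘ U⊆A)

card-mono : ∀ {A B} → A ⊆ B → card A ≤ card B
card-mono {A} A⊆B = Unique-length≤card (deduplicate-! A) (A⊆B ∘ ∈-deduplicate⁻ _≟_ A)

card-map : ∀ {g : ℕ → ℕ} → (∀ {x y} → g x ≡ g y → x ≡ y) → ∀ A → card (map g A) ≡ card A
card-map {g} g-inj A = ≤-antisym ≤card (subst (_≤ card (map g A)) (length-map g (dd A)) ≥card)
  where
    dd = deduplicate _≟_
    ≤card : card (map g A) ≤ card A
    ≤card = begin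
      card (map g A)        ≤⟨ card-mono {B = map g (dd A)} (⊆.map⁺ g (∈-deduplicate⁺ _≟_)) ⟩
      card (map g (dd A))   ≤⟨ length-deduplicate _≟_ (map g (dd A)) ⟩
      length (map g (dd A)) ≡⟨ length-map g (dd A) ⟩
      card A                ∎
      where open ≤-Reasoning
    ≥card : length (map g (dd A)) ≤ card (map g A)
    ≥card = Unique-length≤card {A = map g A} (Unique-map⁺ g-inj (deduplicate-! A))
                               (⊆.map⁺ g (∈-deduplicate⁻ _≟_ A))

card-∷-∉ : ∀ {x A B} → x ∉ A → x ∷ A ⊆ B → suc (card A) ≤ card B
card-∷-∉ {x} {A} {B} x∉A x∷A⊆B =
  Unique-length≤card (x∉ddA ∷ deduplicate-! A) x∷ddA⊆B
  where
    x∉ddA = ¬Any⇒All¬ _ (x∉A ∘ ∈-deduplicate⁻ _≟_ A)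
    x∷ddA⊆B : x ∷ deduplicate _≟_ A ⊆ B
    x∷ddA⊆B (here refl) = x∷A⊆B (here refl)
    x∷ddA⊆B (there y∈) = x∷A⊆B (there (∈-deduplicate⁻ _≟_ A y∈))

0<card⇒∈ : ∀ {A} → 0 < card A → ∃ (_∈ A)
0<card⇒∈ {x ∷ _} _ = x , here refl

card≡0⇒≡[] : ∀ {A} → card A ≡ 0 → A ≡ []
card≡0⇒≡[] {[]} _ = refl

card≤1⇒≡ : ∀ {A a a′} → card A ≤ 1 → a ∈ A → a′ ∈ A → a ≡ a′
card≤1⇒≡ {A} card≤1 a∈A a′∈A =
  length≤1⇒≡ card≤1 (∈-deduplicate⁺ _≟_ a∈A) (∈-deduplicate⁺ _≟_ a′∈A)
  where
    length≤1⇒≡ : ∀ {U : List ℕ} {a a′} → length U ≤ 1 → a ∈ U → a′ ∈ U → a ≡ a′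
    length≤1⇒≡ {_ ∷ []} _ (here refl) (here refl) = refl
    length≤1⇒≡ {_ ∷ _ ∷ _} (s≤s ()) _ _

Unique-∈< : ∀ {U} → Unique U → 1 < length U → ∃₂ λ a a′ → a ∈ U × a′ ∈ U × a < a′
Unique-∈< {x ∷ y ∷ _} ((x≢y ∷ _) ∷ _) _ with <-cmp x y
... | tri< x<y _ _ = x , y , here refl , there (here refl) , x<y
... | tri≈ _ x≡y _ = ⊥-elim (x≢y x≡y)
... | tri> _ _ y<x = y , x , there (here refl) , here refl , y<x
Unique-∈< {_ ∷ []} _ (s≤s ())

1<card⇒∈< : ∀ {A} → 1 < card A → ∃₂ λ a a′ → a ∈ A × a′ ∈ A × a < a′
1<card⇒∈< {A} 1<card with Unique-∈< (deduplicate-! A) 1<card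
... | a , a′ , a∈ , a′∈ , a<a′ =
  a , a′ , ∈-deduplicate⁻ _≟_ A a∈ , ∈-deduplicate⁻ _≟_ A a′∈ , a<a′

max-∈ : ∀ {a A} → a ∈ A → max a A ∈ A
max-∈ {a} {A} a∈A = [ (λ max≡a → subst (_∈ A) (sym max≡a) a∈A) , id ]′ (argmax-sel id a A)

∈-⊕⁺ : ∀ {A B a b} → a ∈ A → b ∈ B → a + b ∈ A ⊕ B
∈-⊕⁺ {B = B} a∈A b∈B =
  ∈-concatMap⁺ (λ a → map (a +_) B) (Any.map (λ { refl → ∈-map⁺ (_ +_) b∈B }) a∈A)

∈-⊕⁻ : ∀ {A B s} → s ∈ A ⊕ B → ∃₂ λ a b → a ∈ A × b ∈ B × s ≡ a + b
∈-⊕⁻ {B = B} s∈A⊕B with find (∈-concatMap⁻ (λ a → map (a +_) B) s∈A⊕B)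
... | a , a∈A , s∈a+B with ∈-map⁻ (a +_) s∈a+B
...   | b , b∈B , s≡a+b = a , b , a∈A , b∈B , s≡a+b

⊕-comm-⊆ : ∀ {A B} → A ⊕ B ⊆ B ⊕ A
⊕-comm-⊆ {A} {B} s∈A⊕B with ∈-⊕⁻ {A} s∈A⊕B
... | a , b , a∈A , b∈B , refl = subst (_∈ B ⊕ A) (+-comm b a) (∈-⊕⁺ b∈B a∈A)

card-⊕-comm : ∀ A B → card (A ⊕ B) ≡ card (B ⊕ A)
card-⊕-comm A B = ≤-antisym (card-mono (⊕-comm-⊆ {A} {B})) (card-mono (⊕-comm-⊆ {B} {A}))

card-⊕-singletonʳ : ∀ {A B b} → b ∈ B → card B ≤ 1 → card (A ⊕ B) ≡ card A
card-⊕-singletonʳ {A} {B} {b} b∈B card≤1 = begin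
  card (A ⊕ B)         ≡⟨ ≤-antisym (card-mono A⊕B⊆A+b) (card-mono A+b⊆A⊕B) ⟩
  card (map (_+ b) A)  ≡⟨ card-map (+-cancelʳ-≡ b _ _) A ⟩
  card A               ∎
  where
    open ≡-Reasoning
    A⊕B⊆A+b : A ⊕ B ⊆ map (_+ b) A
    A⊕B⊆A+b s∈A⊕B with ∈-⊕⁻ {A} s∈A⊕B
    ... | a , b′ , a∈A , b′∈B , refl rewrite card≤1⇒≡ card≤1 b′∈B b∈B = ∈-map⁺ (_+ b) a∈A
    A+b⊆A⊕B : map (_+ b) A ⊆ A ⊕ B
    A+b⊆A⊕B s∈A+b with ∈-map⁻ (_+ b) s∈A+b
    ... | a , a∈A , refl = ∈-⊕⁺ a∈A b∈B

card-⊕-singletonˡ : ∀ {A B a} → a ∈ A → card A ≤ 1 → card (A ⊕ B) ≡ card B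
card-⊕-singletonˡ {A} {B} a∈A card≤1 =
  trans (card-⊕-comm A B) (card-⊕-singletonʳ {A = B} a∈A card≤1)

card-<-⊕ : ∀ {A B a} → a ∈ A → 1 < card B → card A < card (A ⊕ B)
card-<-⊕ {A} {B} {a} a∈A 1<card with 1<card⇒∈< {B} 1<card
... | b , b′ , b∈B , b′∈B , b<b′ =
  subst (_< card (A ⊕ B)) (card-map (+-cancelʳ-≡ b _ _) A) (card-∷-∉ top∉A+b top∷A+b⊆A⊕B)
  where
    m = max a A
    top∉A+b : m + b′ ∉ map (_+ b) A
    top∉A+b top∈A+b with ∈-map⁻ (_+ b) top∈A+b
    ... | x , x∈A , top≡x+b =
      <-irrefl (sym top≡x+b) (+-mono-≤-< (All.lookup (xs≤max a A) x∈A) b<b′)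
    top∷A+b⊆A⊕B : m + b′ ∷ map (_+ b) A ⊆ A ⊕ B
    top∷A+b⊆A⊕B (here refl) = ∈-⊕⁺ (max-∈ a∈A) b′∈B
    top∷A+b⊆A⊕B (there s∈A+b) with ∈-map⁻ (_+ b) s∈A+b
    ... | x , x∈A , refl = ∈-⊕⁺ x∈A b∈B

card-⊔-<-⊕ : ∀ A B → 1 < card A → 1 < card B → card A ⊔ card B < card (A ⊕ B)
card-⊔-<-⊕ A B 1<cardA 1<cardB with 1<card⇒∈< {A} 1<cardA | 1<card⇒∈< {B} 1<cardB
... | a , _ , a∈A , _ | b , _ , b∈B , _ =
  ⊔-pres-<m (card-<-⊕ {B = B} a∈A 1<cardB)
            (subst (card B <_) (card-⊕-comm B A) (card-<-⊕ {B = A} b∈B 1<cardA))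

card-⊕-≢-⊔ : ∀ A B → 1 < card A → 1 < card B → card (A ⊕ B) ≢ card A ⊔ card B
card-⊕-≢-⊔ A B 1<cardA 1<cardB eq = <-irrefl (sym eq) (card-⊔-<-⊕ A B 1<cardA 1<cardB)

card-⊕-≡-⊔ : ∀ A B → 0 < card A → 0 < card B → card A ≤ 1 ⊎ card B ≤ 1
  → card (A ⊕ B) ≡ card A ⊔ card B
card-⊕-≡-⊔ A B 0<cardA 0<cardB (inj₁ cardA≤1) =
  trans (card-⊕-singletonˡ {B = B} (proj₂ (0<card⇒∈ {A} 0<cardA)) cardA≤1)
        (sym (m≤n⇒m⊔n≡n (≤-trans cardA≤1 0<cardB)))
card-⊕-≡-⊔ A B 0<cardA 0<cardB (inj₂ cardB≤1) =
  trans (card-⊕-singletonʳ {A = A} (proj₂ (0<card⇒∈ {B} 0<cardB)) cardB≤1)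
        (sym (m≥n⇒m⊔n≡m (≤-trans cardB≤1 0<cardA)))

CycAdj-irrefl : ∀ {n} → 3 ≤ n → (u : Fin n) → ¬ CycAdj n u u
CycAdj-irrefl _ u (inj₁ 1+u≡u) = 1+n≢n 1+u≡u
CycAdj-irrefl _ u (inj₂ (inj₁ 1+u≡u)) = 1+n≢n 1+u≡u
CycAdj-irrefl 3≤n u (inj₂ (inj₂ (inj₁ (u≡0 , 1+u≡n))))
  with s≤s () ← subst (3 ≤_) (trans (sym 1+u≡n) (cong suc u≡0)) 3≤n
CycAdj-irrefl 3≤n u (inj₂ (inj₂ (inj₂ (u≡0 , 1+u≡n))))
  with s≤s () ← subst (3 ≤_) (trans (sym 1+u≡n) (cong suc u≡0)) 3≤n

CycAdj-neighbour : ∀ {n} (u : Fin n) → ∃ (CycAdj n u)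
CycAdj-neighbour {suc m} u with suc (toℕ u) <? suc m
... | yes u<m = Fin.fromℕ< u<m , inj₁ (sym (toℕ-fromℕ< u<m))
... | no u≮m = Fin.zero , inj₂ (inj₂ (inj₂ (refl , ≤-antisym (toℕ<n u) (≮⇒≥ u≮m))))

weakIASI⇒0<card : ∀ {n} {Adj : Fin n → Fin n → Set} {f : Fin n → SetLabel}
  → (∀ u → ¬ Adj u u) → (∀ u → ∃ (Adj u)) → IsWeakIASI Adj f → ∀ u → 0 < card (f u)
weakIASI⇒0<card {Adj = Adj} {f} irrefl neighbour ((f-inj , _) , weak) u
  with card (f u) in card-fu≡0 | neighbour u
... | suc _ | _ = s≤s z≤n
... | zero | v , uv = ⊥-elim (irrefl u (subst (Adj u) (sym u≡v) uv))
  where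
    fu≡[] : f u ≡ []
    fu≡[] = card≡0⇒≡[] card-fu≡0
    fv≡[] : f v ≡ []
    fv≡[] = card≡0⇒≡[] (sym (subst (λ X → card (X ⊕ f v) ≡ card X ⊔ card (f v))
                                  fu≡[] (weak u v uv)))
    u≡v : u ≡ v
    u≡v = f-inj u v (subst (f u ≈ˢ_) (trans fu≡[] (sym fv≡[])) (λ _ → id , id))

AtMostOneNonSingleton-≢ : ∀ {n} {f : Fin n → SetLabel} → AtMostOneNonSingleton f
  → ∀ {u v} → u ≢ v → card (f u) ≤ 1 ⊎ card (f v) ≤ 1
AtMostOneNonSingleton-≢ {f = f} atMostOne {u} {v} u≢v with 1 <? card (f u)
... | no 1≮fu = inj₁ (≮⇒≥ 1≮fu)
... | yes 1<fu = inj₂ (≮⇒≥ (u≢v ∘ atMostOne u v 1<fu))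

mainTheorem18 : (n : ℕ) → 3 ≤ n → (f : Fin n → SetLabel)
    → IsWeakIASI (CycAdj n) f
    → IsIASI (ComplAdj n) f
    → (IsWeakIASI (ComplAdj n) f → AtMostOneNonSingleton f)
    × (AtMostOneNonSingleton f → IsWeakIASI (ComplAdj n) f)
mainTheorem18 n 3≤n f weakC iasiC̄ = weak⇒atMostOne , atMostOne⇒weak
  where
    weak⇒atMostOne : IsWeakIASI (ComplAdj n) f → AtMostOneNonSingleton f
    weak⇒atMostOne (_ , weakC̄) u v 1<fu 1<fv with u Fin.≟ v
    ... | yes u≡v = u≡v
    -- No decision on CycAdj is needed: the weak condition on C_n refutes it.
    ... | no u≢v = ⊥-elim (¬weak (weakC̄ u v (u≢v , ¬weak ∘ proj₂ weakC u v)))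
      where ¬weak = card-⊕-≢-⊔ (f u) (f v) 1<fu 1<fv

    atMostOne⇒weak : AtMostOneNonSingleton f → IsWeakIASI (ComplAdj n) f
    atMostOne⇒weak atMostOne = iasiC̄ , λ u v (u≢v , _) →
      card-⊕-≡-⊔ (f u) (f v) (0<card u) (0<card v)
                 (AtMostOneNonSingleton-≢ {f = f} atMostOne u≢v)
      where 0<card = weakIASI⇒0<card {f = f} (CycAdj-irrefl 3≤n) CycAdj-neighbour weakC
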